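{- Start with the wheel $C_6\vee K_1$ with rim cycle $(w_1,\dots,w_6,w_1)$ and hub $w_0$ adjacent to $w_1,\dots,w_6$. Add two new adjacent vertices $v_1,v_2$; join $v_1$ to each of $w_1,w_2,w_5$ and join $v_2$ to each of $w_2,w_4,w_5$. Let $\overline{G}$ be the resulting graph and $G$ its complement. Then $\mathcal{I}(G)=\mathcal{A}(G)\cong\theta_{3,3,5}$.
   Context: For a graph $G$, an $i$-set is an independent dominating set of minimum cardinality and an $\alpha$-set is a maximum independent set. The $i$-graph $\mathcal{I}(G)$ has the $i$-sets as vertices, with $X\sim Y$ iff $Y=(X\setminus\{u\})\cup\{v\}$ for some $u\in X$, $v\notin X$ with $uv\in E(G)$; the $\alpha$-graph $\mathcal{A}(G)$ is defined the same way on the $\alpha$-sets. $\theta_{j,k,\ell}$ denotes two vertices joined by three internally vertex-disjoint paths of lengths $j,k,\ell$. -}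

module Defs where

open import Data.Nat using (ℕ; _≤_)
open import Data.Fin using (Fin)
open import Data.Fin.Patterns
open import Data.Fin.Subset using (Subset; _∈_; _∉_; ⁅_⁆; _∪_; _-_; ∣_∣)
open import Data.Product using (Σ; _×_; _,_; ∃; ∃-syntax)
open import Data.Sum using (_⊎_)
open import Data.List using (List; []; _∷_)
open import Data.List.Membership.Propositional using () renaming (_∈_ to _∈ₗ_)
open import Relation.Nullary using (¬_)
open import Relation.Binary.PropositionalEquality using (_≡_; _≢_)

module _ {n : ℕ} (E : Fin n → Fin n → Set) where

  Independent : Subset n → Set
  Independent S = ∀ u v → u ∈ S → v ∈ S → ¬ E u v

  Dominating : Subset n → Set
  Dominating S = ∀ v → v ∈ S ⊎ (∃[ u ] (u ∈ S × E u v))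

  IndependentDominating : Subset n → Set
  IndependentDominating S = Independent S × Dominating S

  IsISet : Subset n → Set
  IsISet S = IndependentDominating S
           × (∀ T → IndependentDominating T → ∣ S ∣ ≤ ∣ T ∣)

  IsAlphaSet : Subset n → Set
  IsAlphaSet S = Independent S × (∀ T → Independent T → ∣ T ∣ ≤ ∣ S ∣)

  -- The adjacency of the i-graph / α-graph (same rule for both):
  -- Y = (X \ {u}) ∪ {v} with u ∈ X, v ∉ X, uv ∈ E(G).
  TokenSlide : Subset n → Subset n → Set
  TokenSlide X Y = ∃[ u ] ∃[ v ] (u ∈ X × v ∉ X × E u v × Y ≡ (X - u) ∪ ⁅ v ⁆)

EdgeAdj : {n : ℕ} → List (Fin n × Fin n) → Fin n → Fin n → Set
EdgeAdj es u v = ((u , v) ∈ₗ es) ⊎ ((v , u) ∈ₗ es)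

-- The graph Ḡ.  Vertex numbering in Fin 9:
--   0 = w₀ (hub), 1..6 = w₁..w₆ (rim), 7 = v₁, 8 = v₂.

GbarEdges : List (Fin 9 × Fin 9)
GbarEdges =
    (1F , 2F) ∷ (2F , 3F) ∷ (3F , 4F) ∷ (4F , 5F) ∷ (5F , 6F) ∷ (6F , 1F)
  ∷ (0F , 1F) ∷ (0F , 2F) ∷ (0F , 3F) ∷ (0F , 4F) ∷ (0F , 5F) ∷ (0F , 6F)
  ∷ (7F , 8F)
  ∷ (7F , 1F) ∷ (7F , 2F) ∷ (7F , 5F)
  ∷ (8F , 2F) ∷ (8F , 4F) ∷ (8F , 5F)
  ∷ []

GbarAdj : Fin 9 → Fin 9 → Set
GbarAdj = EdgeAdj GbarEdges

GAdj : Fin 9 → Fin 9 → Set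
GAdj u v = u ≢ v × ¬ GbarAdj u v

-- θ_{3,3,5}: two vertices x = 0, y = 1 joined by internally disjoint
-- paths of lengths 3, 3, 5.  Vertex numbering in Fin 10:
--   path 1: 0 - 2 - 3 - 1
--   path 2: 0 - 4 - 5 - 1
--   path 3: 0 - 6 - 7 - 8 - 9 - 1

Theta335Edges : List (Fin 10 × Fin 10)
Theta335Edges =
    (0F , 2F) ∷ (2F , 3F) ∷ (3F , 1F)
  ∷ (0F , 4F) ∷ (4F , 5F) ∷ (5F , 1F)
  ∷ (0F , 6F) ∷ (6F , 7F) ∷ (7F , 8F) ∷ (8F , 9F) ∷ (9F , 1F)
  ∷ []

Theta335Adj : Fin 10 → Fin 10 → Set
Theta335Adj = EdgeAdj Theta335Edges

-- Independent sets of G are cliques of Ḡ, and every maximal clique of Ḡ is a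
-- triangle: G is well-covered with i(G) = α(G) = 3. As a maximum independent
-- set is always dominating, the i-sets and α-sets of G then coincide; they are
-- the ten triangles of Ḡ. Two of them are adjacent in I(G) exactly when they
-- share an edge (the exchanged vertices are non-adjacent in Ḡ, which has no K₄).
-- The six triangles through the hub form two paths of length 3 around the rim
-- from {w₀,w₁,w₂} to {w₀,w₄,w₅}, and the four triangles through v₁ or v₂ join
-- the same ends by a path of length 5. The facts about this particular graph are
-- verified by exhaustive search.
module Submission where

open import Defs
open import Data.Bool using (Bool; true; false; T; T?)
import Data.Bool as Bool
open import Data.Fin using (Fin; _≟_)
open import Data.Fin.Patterns
open import Data.Fin.Properties using (all?; any?)
open import Data.Fin.Subset using (Subset; _∈_; _⊂_; ⁅_⁆; _∪_; _-_; ∣_∣)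
open import Data.Fin.Subset.Properties
  using (_∈?_; anySubset?; p⊆p∪q; x∈p∪q⁺; x∈p∪q⁻; x∈⁅x⁆; x∈⁅y⁆⇒x≡y; p⊂q⇒∣p∣<∣q∣)
open import Data.List using (List)
open import Data.Nat using (ℕ; _≤_; _≤?_)
import Data.Nat as ℕ
open import Data.Nat.Properties using (≤-reflexive; ≤-trans; <⇒≱)
import Data.Product.Properties as ×
open import Data.Product using (Σ; _×_; _,_; proj₁; ∃-syntax)
open import Data.Sum using (_⊎_; inj₁; inj₂)
import Data.Sum as Sum
open import Data.Unit using (tt)
open import Data.Vec using (Vec; []; _∷_; lookup)
open import Data.Vec.Properties using (≡-dec)
open import Function using (_∘_)
open import Function.Bundles using (_⇔_; mk⇔; module Equivalence)
open import Function.Definitions using (Injective)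
open import Relation.Binary.Definitions using (Decidable; DecidableEquality; Symmetric; Irreflexive)
open import Relation.Binary.PropositionalEquality using (_≡_; refl; sym; trans)
open import Relation.Nullary using (Dec; yes; no; ¬_; contradiction)
open import Relation.Nullary.Decidable
  using (_×-dec_; _⊎-dec_; _→-dec_; ¬?; map′; toWitness; decidable-stable)

module _ {n : ℕ} {E : Fin n → Fin n → Set} where

  Undominated : Subset n → Fin n → Set
  Undominated S v = ¬ (v ∈ S ⊎ ∃[ u ] (u ∈ S × E u v))

  independent-∪-undominated : Symmetric E → Irreflexive _≡_ E →
    ∀ {S v} → Independent E S → Undominated S v → Independent E (S ∪ ⁅ v ⁆)
  independent-∪-undominated sym-E irrefl-E {S} {v} indS undom u w u∈ w∈
    with x∈p∪q⁻ S ⁅ v ⁆ u∈ | x∈p∪q⁻ S ⁅ v ⁆ w∈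
  ... | inj₁ u∈S | inj₁ w∈S = indS u w u∈S w∈S
  ... | inj₁ u∈S | inj₂ w∈v rewrite x∈⁅y⁆⇒x≡y v w∈v = λ Euv → undom (inj₂ (u , u∈S , Euv))
  ... | inj₂ u∈v | inj₁ w∈S rewrite x∈⁅y⁆⇒x≡y v u∈v = λ Evw → undom (inj₂ (w , w∈S , sym-E Evw))
  ... | inj₂ u∈v | inj₂ w∈v = irrefl-E (trans (x∈⁅y⁆⇒x≡y v u∈v) (sym (x∈⁅y⁆⇒x≡y v w∈v)))

  ⊂-∪-undominated : ∀ {S v} → Undominated S v → S ⊂ S ∪ ⁅ v ⁆
  ⊂-∪-undominated {S} {v} undom = p⊆p∪q ⁅ v ⁆ , v , x∈p∪q⁺ (inj₂ (x∈⁅x⁆ v)) , undom ∘ inj₁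

  αSet⇒dominating : Symmetric E → Irreflexive _≡_ E → Decidable E →
    ∀ {S} → IsAlphaSet E S → Dominating E S
  αSet⇒dominating sym-E irrefl-E E? {S} (indS , maxS) v
    with (v ∈? S) ⊎-dec any? (λ u → (u ∈? S) ×-dec E? u v)
  ... | yes dominated = dominated
  ... | no undom = contradiction
        (maxS (S ∪ ⁅ v ⁆) (independent-∪-undominated sym-E irrefl-E indS undom))
        (<⇒≱ (p⊂q⇒∣p∣<∣q∣ (⊂-∪-undominated undom)))

  module WellCovered (sym-E : Symmetric E) (irrefl-E : Irreflexive _≡_ E) (E? : Decidable E)
    {k : ℕ} (independent-≤ : ∀ T → Independent E T → ∣ T ∣ ≤ k)
    (independentDominating-≡ : ∀ T → IndependentDominating E T → ∣ T ∣ ≡ k) where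

    independentDominating⇒iSet : ∀ {S} → IndependentDominating E S → IsISet E S
    independentDominating⇒iSet {S} idS = idS , λ T idT →
      ≤-reflexive (trans (independentDominating-≡ S idS) (sym (independentDominating-≡ T idT)))

    iSet⇒αSet : ∀ {S} → IsISet E S → IsAlphaSet E S
    iSet⇒αSet {S} (idS , _) = proj₁ idS , λ T indT →
      ≤-trans (independent-≤ T indT) (≤-reflexive (sym (independentDominating-≡ S idS)))

    αSet⇒iSet : ∀ {S} → IsAlphaSet E S → IsISet E S
    αSet⇒iSet αS = independentDominating⇒iSet
      (proj₁ αS , αSet⇒dominating sym-E irrefl-E E? αS)

    iSet⇔αSet : ∀ S → IsISet E S ⇔ IsAlphaSet E S
    iSet⇔αSet S = mk⇔ iSet⇒αSet αSet⇒iSet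

allSubsets? : ∀ {n} {P : Subset n → Set} → (∀ S → Dec (P S)) → Dec (∀ S → P S)
allSubsets? P? with anySubset? (¬? ∘ P?)
... | yes (S , ¬PS) = no λ ∀P → ¬PS (∀P S)
... | no ¬∃¬P       = yes λ S → decidable-stable (P? S) (λ ¬PS → ¬∃¬P (S , ¬PS))

_⇔-dec_ : ∀ {A B : Set} → Dec A → Dec B → Dec (A ⇔ B)
a? ⇔-dec b? = map′ (λ (f , g) → mk⇔ f g) (λ e → Equivalence.to e , Equivalence.from e)
                   ((a? →-dec b?) ×-dec (b? →-dec a?))

_≟ˢ_ : ∀ {n} → DecidableEquality (Subset n)
_≟ˢ_ = ≡-dec Bool._≟_

module _ {n : ℕ} {E : Fin n → Fin n → Set} (E? : Decidable E) where

  independent? : ∀ S → Dec (Independent E S)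
  independent? S = all? λ u → all? λ v → (u ∈? S) →-dec (v ∈? S) →-dec ¬? (E? u v)

  dominating? : ∀ S → Dec (Dominating E S)
  dominating? S = all? λ v → (v ∈? S) ⊎-dec any? λ u → (u ∈? S) ×-dec E? u v

  tokenSlide? : ∀ X Y → Dec (TokenSlide E X Y)
  tokenSlide? X Y = any? λ u → any? λ v →
    (u ∈? X) ×-dec ¬? (v ∈? X) ×-dec E? u v ×-dec (Y ≟ˢ ((X - u) ∪ ⁅ v ⁆))

edgeAdj? : ∀ {n} (es : List (Fin n × Fin n)) → Decidable (EdgeAdj es)
edgeAdj? es u v = ((u , v) ∈ₗ? es) ⊎-dec ((v , u) ∈ₗ? es)
  where open import Data.List.Membership.DecPropositional (×.≡-dec _≟_ _≟_)
          using () renaming (_∈?_ to _∈ₗ?_)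

GAdj-sym : Symmetric GAdj
GAdj-sym (u≢v , ¬uv) = u≢v ∘ sym , ¬uv ∘ Sum.swap

GAdj-irrefl : Irreflexive _≡_ GAdj
GAdj-irrefl u≡v (u≢v , _) = u≢v u≡v

-- Deciding adjacency by table lookup instead of from the edge list of Ḡ is what
-- keeps the searches through all 2⁹ subsets below affordable.
GAdjMatrix : Vec (Vec Bool 9) 9
GAdjMatrix =
    (false ∷ false ∷ false ∷ false ∷ false ∷ false ∷ false ∷ true  ∷ true  ∷ [])
  ∷ (false ∷ false ∷ false ∷ true  ∷ true  ∷ true  ∷ false ∷ false ∷ true  ∷ [])
  ∷ (false ∷ false ∷ false ∷ false ∷ true  ∷ true  ∷ true  ∷ false ∷ false ∷ [])
  ∷ (false ∷ true  ∷ false ∷ false ∷ false ∷ true  ∷ true  ∷ true  ∷ true  ∷ [])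
  ∷ (false ∷ true  ∷ true  ∷ false ∷ false ∷ false ∷ true  ∷ true  ∷ false ∷ [])
  ∷ (false ∷ true  ∷ true  ∷ true  ∷ false ∷ false ∷ false ∷ false ∷ false ∷ [])
  ∷ (false ∷ false ∷ true  ∷ true  ∷ true  ∷ false ∷ false ∷ true  ∷ true  ∷ [])
  ∷ (true  ∷ false ∷ false ∷ true  ∷ true  ∷ false ∷ true  ∷ false ∷ false ∷ [])
  ∷ (true  ∷ true  ∷ false ∷ true  ∷ false ∷ false ∷ true  ∷ false ∷ false ∷ [])
  ∷ []

GAdjMatrix-correct : ∀ u v → T (lookup (lookup GAdjMatrix u) v) ⇔ GAdj u v
GAdjMatrix-correct = toWitness {a? = all? λ u → all? λ v →
  T? (lookup (lookup GAdjMatrix u) v) ⇔-dec (¬? (u ≟ v) ×-dec ¬? (edgeAdj? GbarEdges u v))} tt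

GAdj? : Decidable GAdj
GAdj? u v = map′ to from (T? (lookup (lookup GAdjMatrix u) v))
  where open Equivalence (GAdjMatrix-correct u v)

triangle : Fin 9 → Fin 9 → Fin 9 → Subset 9
triangle a b c = ⁅ a ⁆ ∪ ⁅ b ⁆ ∪ ⁅ c ⁆

iSetAt : Fin 10 → Subset 9
iSetAt 0F = triangle 0F 1F 2F
iSetAt 1F = triangle 0F 4F 5F
iSetAt 2F = triangle 0F 1F 6F
iSetAt 3F = triangle 0F 5F 6F
iSetAt 4F = triangle 0F 2F 3F
iSetAt 5F = triangle 0F 3F 4F
iSetAt 6F = triangle 1F 2F 7F
iSetAt 7F = triangle 2F 7F 8F
iSetAt 8F = triangle 5F 7F 8F
iSetAt 9F = triangle 4F 5F 8F

-- Abstract, so that unification never unfolds the exhaustive searches.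
abstract
  independent-≤3 : ∀ T → Independent GAdj T → ∣ T ∣ ≤ 3
  independent-≤3 = toWitness {a? = allSubsets? λ T → independent? GAdj? T →-dec ∣ T ∣ ≤? 3} tt

  independentDominating⇒iSetAt : ∀ T → IndependentDominating GAdj T → ∃[ t ] iSetAt t ≡ T
  independentDominating⇒iSetAt = toWitness
    {a? = allSubsets? λ T → (independent? GAdj? T ×-dec dominating? GAdj? T)
                            →-dec any? λ t → iSetAt t ≟ˢ T} tt

  iSetAt-independentDominating : ∀ t → IndependentDominating GAdj (iSetAt t)
  iSetAt-independentDominating = toWitness
    {a? = all? λ t → independent? GAdj? (iSetAt t) ×-dec dominating? GAdj? (iSetAt t)} tt

  ∣iSetAt∣≡3 : ∀ t → ∣ iSetAt t ∣ ≡ 3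
  ∣iSetAt∣≡3 = toWitness {a? = all? λ t → ∣ iSetAt t ∣ ℕ.≟ 3} tt

  iSetAt-injective : Injective _≡_ _≡_ iSetAt
  iSetAt-injective {s} {t} = toWitness
    {a? = all? λ s → all? λ t → (iSetAt s ≟ˢ iSetAt t) →-dec (s ≟ t)} tt s t

  theta⇔tokenSlide : ∀ s t → Theta335Adj s t ⇔ TokenSlide GAdj (iSetAt s) (iSetAt t)
  theta⇔tokenSlide = toWitness
    {a? = all? λ s → all? λ t → edgeAdj? Theta335Edges s t ⇔-dec tokenSlide? GAdj? (iSetAt s) (iSetAt t)} tt

independentDominating-≡3 : ∀ T → IndependentDominating GAdj T → ∣ T ∣ ≡ 3
independentDominating-≡3 T idT with independentDominating⇒iSetAt T idT
... | t , refl = ∣iSetAt∣≡3 t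

open WellCovered GAdj-sym GAdj-irrefl GAdj? independent-≤3 independentDominating-≡3

mainTheorem19 :
    (∀ (S : Subset 9) → IsISet GAdj S ⇔ IsAlphaSet GAdj S)
    × (Σ (Fin 10 → Subset 9) λ g →
         Injective _≡_ _≡_ g
         × (∀ t → IsISet GAdj (g t))
         × (∀ S → IsISet GAdj S → ∃[ t ] (g t ≡ S))
         × (∀ s t → Theta335Adj s t ⇔ TokenSlide GAdj (g s) (g t)))
mainTheorem19 =
    iSet⇔αSet
  , iSetAt
  , iSetAt-injective
  , independentDominating⇒iSet ∘ iSetAt-independentDominating
  , (λ S → independentDominating⇒iSetAt S ∘ proj₁)
  , theta⇔tokenSlide
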